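{- Let $\ell$ be a line of $\mathrm{PG}_q(\mathbb{F}_{q^t})$ with $o(\ell)=m$ and let $d$ be an integer. Then $\ell^d$ is contained in an $(m-1)$-dimensional subspace of $\mathrm{PG}_q(\mathbb{F}_{q^t})$. Moreover, there is a line $\ell'$ of $\mathrm{PG}_q(\mathbb{F}_{q^m})\subseteq\mathrm{PG}_q(\mathbb{F}_{q^t})$ with $o(\ell')=o(\ell)$ such that $\ell^d$ is $\mathrm{PGL}(t,q)$-equivalent to $\ell'^d$.
   Context: $\mathrm{PG}_q(\mathbb{F}_{q^t})\cong\mathrm{PG}(t-1,q)$ has as points the sets $\langle x\rangle_q=\mathbb{F}_q x$, $x\in\mathbb{F}_{q^t}^*$. For a line $\ell$ with underlying two-dimensional $\mathbb{F}_q$-subspace $\hat\ell$, $o(\ell)$ is the smallest positive integer $m$ such that $\hat\ell$ is contained in a one-dimensional $\mathbb{F}_{q^m}$-subspace of $\mathbb{F}_{q^t}$ ($\mathbb{F}_{q^m}$ a subfield). For an integer $d$ and a point set $\mathcal{H}$, $\mathcal{H}^d=\{\langle x^d\rangle_q:\langle x\rangle_q\in\mathcal{H}\}$. -}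

module Defs where

open import Data.Nat using (ℕ; zero; suc; _^_; _≤_; _<_)
open import Data.Integer using (ℤ; +_; -[1+_])
open import Data.Fin using (Fin)
open import Data.Bool using (Bool; T)
open import Data.Product using (Σ; ∃; ∃-syntax; _×_; _,_)
open import Relation.Binary.PropositionalEquality using (_≡_; _≢_)
open import Relation.Nullary using (¬_)
open import Function.Bundles using (_↔_)
open import Algebra.Structures using (IsCommutativeRing)

record FiniteField : Set₁ where
  infixl 6 _+_
  infixl 7 _*_
  field
    K     : Set
    _+_   : K → K → K
    _*_   : K → K → K
    -_    : K → K
    0#    : K
    1#    : K
    _⁻¹   : K → K
    isCommutativeRing : IsCommutativeRing _≡_ _+_ _*_ -_ 0# 1#
    0≢1   : 0# ≢ 1#
    inverseʳ : ∀ x → x ≢ 0# → x * (x ⁻¹) ≡ 1#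
    size  : ℕ
    enum  : Fin size ↔ K

module FF (𝕂 : FiniteField) where
  open FiniteField 𝕂 public

  Subset : Set
  Subset = K → Bool

  _∈_ : K → Subset → Set
  x ∈ S = T (S x)

  HasSize : Subset → ℕ → Set
  HasSize S n = Fin n ↔ Σ K (λ x → x ∈ S)

  record IsSubfield (S : Subset) : Set where
    field
      0∈  : 0# ∈ S
      1∈  : 1# ∈ S
      +∈  : ∀ {x y} → x ∈ S → y ∈ S → (x + y) ∈ S
      -∈  : ∀ {x} → x ∈ S → (- x) ∈ S
      *∈  : ∀ {x y} → x ∈ S → y ∈ S → (x * y) ∈ S
      ⁻¹∈ : ∀ {x} → x ∈ S → (x ⁻¹) ∈ S

  _⊆_ : Subset → Subset → Set
  S ⊆ S' = ∀ x → x ∈ S → x ∈ S'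

  powℕ : K → ℕ → K
  powℕ x zero    = 1#
  powℕ x (suc n) = x * powℕ x n

  powℤ : K → ℤ → K
  powℤ x (+ n)     = powℕ x n
  powℤ x -[1+ n ]  = powℕ (x ⁻¹) (suc n)

  sumFin : (n : ℕ) → (Fin n → K) → K
  sumFin zero    f = 0#
  sumFin (suc n) f = f Fin.zero + sumFin n (λ i → f (Fin.suc i))

  -- Everything below is relative to a subfield F (= 𝔽_q) of K.
  module OverF (F : Subset) where

    SamePoint : K → K → Set
    SamePoint u v = ∃[ λ' ] (λ' ∈ F × λ' ≢ 0# × u ≡ λ' * v)

    InSpan : (n : ℕ) → (Fin n → K) → K → Set
    InSpan n w x = Σ (Fin n → K) λ c → ((∀ i → c i ∈ F) × x ≡ sumFin n (λ i → c i * w i))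

    -- (a , b) is an F-basis of a 2-dim F-subspace, i.e. spans a line ℓ
    IsLine : K → K → Set
    IsLine a b = ∀ λ₁ λ₂ → λ₁ ∈ F → λ₂ ∈ F → λ₁ * a + λ₂ * b ≡ 0# → λ₁ ≡ 0# × λ₂ ≡ 0#

    InLine : K → K → K → Set
    InLine a b x = ∃[ λ₁ ] ∃[ λ₂ ] (λ₁ ∈ F × λ₂ ∈ F × x ≡ λ₁ * a + λ₂ * b)

    -- ℓ̂ is contained in a 1-dim 𝔽_{q^m}-subspace E·c, where E is the
    -- subfield of order q^m (containing F).
    ContainedIn1dim : (q m : ℕ) → K → K → Set
    ContainedIn1dim q m a b =
      ∃[ E ] (IsSubfield E × HasSize E (q ^ m) × F ⊆ E ×
        ∃[ c ] (∀ x → InLine a b x → ∃[ e ] (e ∈ E × x ≡ e * c)))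

    HasOrder : (q : ℕ) → K → K → ℕ → Set
    HasOrder q a b m =
      1 ≤ m × ContainedIn1dim q m a b ×
      (∀ m' → 1 ≤ m' → m' < m → ¬ ContainedIn1dim q m' a b)

    -- F-linear bijection of K (an element of GL(t,q), inducing PGL(t,q))
    record FLinearBijection : Set where
      field
        φ      : K → K
        additive : ∀ x y → φ (x + y) ≡ φ x + φ y
        F-homog  : ∀ λ' x → λ' ∈ F → φ (λ' * x) ≡ λ' * φ x
        bij      : Σ (K → K) (λ ψ → (∀ x → ψ (φ x) ≡ x) × (∀ y → φ (ψ y) ≡ y))

    -- ℓ₁^d and ℓ₂^d are equivalent under the collineation induced by g:
    -- g maps the point set ℓ₁^d onto the point set ℓ₂^d.
    PGLEquivalentPowers : FLinearBijection → ℤ → K → K → K → K → Set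
    PGLEquivalentPowers g d a b a' b' =
      (∀ x → InLine a b x → x ≢ 0# →
         ∃[ y ] (InLine a' b' y × y ≢ 0# × SamePoint (φ (powℤ x d)) (powℤ y d)))
      × (∀ y → InLine a' b' y → y ≢ 0# →
         ∃[ x ] (InLine a b x × x ≢ 0# × SamePoint (φ (powℤ x d)) (powℤ y d)))
      where open FLinearBijection g

module Submission where

-- Every vector of ℓ̂ is e·c with e ∈ E, hence x^d = e^d · c^d.
--
-- (1) E is spanned over F = 𝔽_q by m elements w₀,…,w_{m-1}: a greedy
--     construction either stops with a spanning family or produces
--     independent families, and an independent family of length k inside E
--     forces q^k ≤ |E| (its F-combinations are pairwise distinct), so it
--     cannot outgrow m.  Then every x^d lies in the span of the w_i·c^d,
--     i.e. ℓ^d lies in an (m-1)-dimensional subspace.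
-- (2) Write a = a'c, b = b'c with a', b' ∈ E.  Dividing a line by a nonzero
--     scalar keeps it a line of the same order, and the F-linear bijection
--     x ↦ x·(c⁻¹)^d maps the point set ℓ^d onto ℓ'^d for ℓ' = ⟨a' , b'⟩.

open import Defs
open import Data.Nat using (ℕ; zero; suc; _^_; _≤_)
open import Data.Nat.Properties using (<⇒≱; n<1+n; ^-monoʳ-<)
open import Data.Integer using (ℤ; -[1+_]) renaming (+_ to pos)
open import Data.Fin using (Fin) renaming (zero to fzero; suc to fsuc)
open import Data.Fin.Base using (combine; finToFun; funToFin)
import Data.Fin.Properties as Finₚ
open import Data.Bool.Properties using (T-irrelevant)
open import Data.Product using (Σ; ∃; ∃-syntax; _×_; _,_; proj₁; proj₂)
open import Data.Sum using (_⊎_; inj₁; inj₂)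
open import Data.Empty using (⊥-elim)
open import Level using (0ℓ)
open import Function.Bundles using (Inverse; Injection; _↔_)
open import Function.Properties.Inverse using (↔⇒↣; ↔-sym)
open import Relation.Binary.PropositionalEquality
open import Relation.Nullary using (¬_; Dec; yes; no)
open import Relation.Nullary.Decidable using (map′; T?; ¬?; _×-dec_; decidable-stable)
open import Algebra.Bundles using (CommutativeRing)
import Algebra.Properties.Ring as RingProperties
import Algebra.Properties.CommutativeSemigroup as CommutativeSemigroupProperties

to-injective : ∀ {A B : Set} (f : A ↔ B) {x y : A} → Inverse.to f x ≡ Inverse.to f y → x ≡ y
to-injective f = Injection.injective (↔⇒↣ f)

from-injective : ∀ {A B : Set} (f : A ↔ B) {x y : B} → Inverse.from f x ≡ Inverse.from f y → x ≡ y
from-injective f = to-injective (↔-sym f)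

module FieldFacts (𝕂 : FiniteField) where
  open FF 𝕂
  open ≡-Reasoning

  commutativeRing : CommutativeRing 0ℓ 0ℓ
  commutativeRing = record
    { Carrier = K ; _≈_ = _≡_ ; _+_ = _+_ ; _*_ = _*_ ; -_ = -_ ; 0# = 0# ; 1# = 1#
    ; isCommutativeRing = isCommutativeRing }

  open CommutativeRing commutativeRing public
    using (+-identityˡ; +-identityʳ; -‿inverseʳ;
           *-assoc; *-comm; *-identityˡ; *-identityʳ; distribʳ; zeroˡ; zeroʳ)
  open RingProperties (CommutativeRing.ring commutativeRing) public
    using (-‿distribˡ-*; -‿distribʳ-*; [y-z]x≈yx-zx; -‿+-comm; +-inverseˡ-unique; x∙y⁻¹≈ε⇒x≈y)
  open CommutativeSemigroupProperties (CommutativeRing.+-commutativeSemigroup commutativeRing)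
    public using () renaming (interchange to +-interchange)
  open CommutativeSemigroupProperties (CommutativeRing.*-commutativeSemigroup commutativeRing)
    public using () renaming (interchange to *-interchange)

  -- Finiteness of K makes equality and existential statements decidable.
  module Enum = Inverse enum

  _≟_ : (x y : K) → Dec (x ≡ y)
  x ≟ y = map′ (from-injective enum) (cong Enum.from) (Enum.from x Finₚ.≟ Enum.from y)

  ∃? : (P : K → Set) → (∀ x → Dec (P x)) → Dec (∃ P)
  ∃? P P? = map′ (λ (i , p) → Enum.to i , p)
                 (λ (x , p) → Enum.from x , subst P (sym (Enum.strictlyInverseˡ x)) p)
                 (Finₚ.any? (λ i → P? (Enum.to i)))

  1≢0 : 1# ≢ 0#
  1≢0 e = 0≢1 (sym e)

  0*x+s≡s : ∀ x s → 0# * x + s ≡ s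
  0*x+s≡s x s = trans (cong (_+ s) (zeroˡ x)) (+-identityˡ s)

  ⁻¹-inverseˡ : ∀ x → x ≢ 0# → x ⁻¹ * x ≡ 1#
  ⁻¹-inverseˡ x x≢0 = trans (*-comm (x ⁻¹) x) (inverseʳ x x≢0)

  ⁻¹-*-cancelˡ : ∀ x y → x ≢ 0# → x ⁻¹ * (x * y) ≡ y
  ⁻¹-*-cancelˡ x y x≢0 = begin
    x ⁻¹ * (x * y)   ≡⟨ *-assoc (x ⁻¹) x y ⟨
    (x ⁻¹ * x) * y   ≡⟨ cong (_* y) (⁻¹-inverseˡ x x≢0) ⟩
    1# * y           ≡⟨ *-identityˡ y ⟩
    y                ∎

  zero-product : ∀ x y → x ≢ 0# → x * y ≡ 0# → y ≡ 0#
  zero-product x y x≢0 xy≡0 = begin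
    y                ≡⟨ ⁻¹-*-cancelˡ x y x≢0 ⟨
    x ⁻¹ * (x * y)   ≡⟨ cong (x ⁻¹ *_) xy≡0 ⟩
    x ⁻¹ * 0#        ≡⟨ zeroʳ (x ⁻¹) ⟩
    0#               ∎

  *-nonzero : ∀ x y → x ≢ 0# → y ≢ 0# → x * y ≢ 0#
  *-nonzero x y x≢0 y≢0 xy≡0 = y≢0 (zero-product x y x≢0 xy≡0)

  nonzero-factorˡ : ∀ x y → x * y ≢ 0# → x ≢ 0#
  nonzero-factorˡ x y xy≢0 x≡0 = xy≢0 (trans (cong (_* y) x≡0) (zeroˡ y))

  nonzero-factorʳ : ∀ x y → x * y ≢ 0# → y ≢ 0#
  nonzero-factorʳ x y xy≢0 y≡0 = xy≢0 (trans (cong (x *_) y≡0) (zeroʳ x))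

  ⁻¹-nonzero : ∀ x → x ≢ 0# → x ⁻¹ ≢ 0#
  ⁻¹-nonzero x x≢0 x⁻¹≡0 = 0≢1 (begin
    0#         ≡⟨ zeroʳ x ⟨
    x * 0#     ≡⟨ cong (x *_) x⁻¹≡0 ⟨
    x * x ⁻¹   ≡⟨ inverseʳ x x≢0 ⟩
    1#         ∎)

  ⁻¹-unique : ∀ x y → x ≢ 0# → x * y ≡ 1# → y ≡ x ⁻¹
  ⁻¹-unique x y x≢0 xy≡1 = begin
    y                 ≡⟨ ⁻¹-*-cancelˡ x y x≢0 ⟨
    x ⁻¹ * (x * y)    ≡⟨ cong (x ⁻¹ *_) xy≡1 ⟩
    x ⁻¹ * 1#         ≡⟨ *-identityʳ (x ⁻¹) ⟩
    x ⁻¹              ∎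

  ⁻¹-distrib-* : ∀ x y → x ≢ 0# → y ≢ 0# → (x * y) ⁻¹ ≡ x ⁻¹ * y ⁻¹
  ⁻¹-distrib-* x y x≢0 y≢0 = sym (⁻¹-unique (x * y) (x ⁻¹ * y ⁻¹) (*-nonzero x y x≢0 y≢0) (begin
    (x * y) * (x ⁻¹ * y ⁻¹)     ≡⟨ *-interchange x y (x ⁻¹) (y ⁻¹) ⟩
    (x * x ⁻¹) * (y * y ⁻¹)     ≡⟨ cong₂ _*_ (inverseʳ x x≢0) (inverseʳ y y≢0) ⟩
    1# * 1#                     ≡⟨ *-identityˡ 1# ⟩
    1#                          ∎))

  *-⁻¹-cancelʳ : ∀ x c → c ≢ 0# → (x * c) * c ⁻¹ ≡ x
  *-⁻¹-cancelʳ x c c≢0 = begin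
    (x * c) * c ⁻¹   ≡⟨ *-assoc x c (c ⁻¹) ⟩
    x * (c * c ⁻¹)   ≡⟨ cong (x *_) (inverseʳ c c≢0) ⟩
    x * 1#           ≡⟨ *-identityʳ x ⟩
    x                ∎

  ⁻¹-*-cancelʳ : ∀ x c → c ≢ 0# → (x * c ⁻¹) * c ≡ x
  ⁻¹-*-cancelʳ x c c≢0 = begin
    (x * c ⁻¹) * c   ≡⟨ *-assoc x (c ⁻¹) c ⟩
    x * (c ⁻¹ * c)   ≡⟨ cong (x *_) (⁻¹-inverseˡ c c≢0) ⟩
    x * 1#           ≡⟨ *-identityʳ x ⟩
    x                ∎

  powℕ-distrib-* : ∀ x y n → powℕ (x * y) n ≡ powℕ x n * powℕ y n
  powℕ-distrib-* x y zero    = sym (*-identityˡ 1#)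
  powℕ-distrib-* x y (suc n) = begin
    (x * y) * powℕ (x * y) n          ≡⟨ cong ((x * y) *_) (powℕ-distrib-* x y n) ⟩
    (x * y) * (powℕ x n * powℕ y n)   ≡⟨ *-interchange x y (powℕ x n) (powℕ y n) ⟩
    (x * powℕ x n) * (y * powℕ y n)   ∎

  powℤ-distrib-* : ∀ x y d → x ≢ 0# → y ≢ 0# → powℤ (x * y) d ≡ powℤ x d * powℤ y d
  powℤ-distrib-* x y (pos n)    _   _   = powℕ-distrib-* x y n
  powℤ-distrib-* x y -[1+ n ] x≢0 y≢0 = begin
    powℕ ((x * y) ⁻¹) (suc n)        ≡⟨ cong (λ z → powℕ z (suc n)) (⁻¹-distrib-* x y x≢0 y≢0) ⟩
    powℕ (x ⁻¹ * y ⁻¹) (suc n)       ≡⟨ powℕ-distrib-* (x ⁻¹) (y ⁻¹) (suc n) ⟩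
    powℕ (x ⁻¹) (suc n) * powℕ (y ⁻¹) (suc n) ∎

  powℕ-nonzero : ∀ x n → x ≢ 0# → powℕ x n ≢ 0#
  powℕ-nonzero x zero    _   = 1≢0
  powℕ-nonzero x (suc n) x≢0 = *-nonzero x (powℕ x n) x≢0 (powℕ-nonzero x n x≢0)

  powℤ-nonzero : ∀ x d → x ≢ 0# → powℤ x d ≢ 0#
  powℤ-nonzero x (pos n)    x≢0 = powℕ-nonzero x n x≢0
  powℤ-nonzero x -[1+ n ] x≢0 = powℕ-nonzero (x ⁻¹) (suc n) (⁻¹-nonzero x x≢0)

  module _ {S : Subset} (sfS : IsSubfield S) where
    open IsSubfield sfS

    powℕ∈ : ∀ {x} n → x ∈ S → powℕ x n ∈ S
    powℕ∈ zero    _   = 1∈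
    powℕ∈ (suc n) x∈S = *∈ x∈S (powℕ∈ n x∈S)

    powℤ∈ : ∀ {x} d → x ∈ S → powℤ x d ∈ S
    powℤ∈ (pos n)    x∈S = powℕ∈ n x∈S
    powℤ∈ -[1+ n ] x∈S = powℕ∈ (suc n) (⁻¹∈ x∈S)

module Sums (𝕂 : FiniteField) where
  open FF 𝕂
  open FieldFacts 𝕂
  open ≡-Reasoning

  sum-cong : ∀ n {f g : Fin n → K} → (∀ i → f i ≡ g i) → sumFin n f ≡ sumFin n g
  sum-cong zero    _   = refl
  sum-cong (suc n) f≗g = cong₂ _+_ (f≗g fzero) (sum-cong n (λ i → f≗g (fsuc i)))

  sum-*ʳ : ∀ n (f : Fin n → K) z → sumFin n f * z ≡ sumFin n (λ i → f i * z)
  sum-*ʳ zero    f z = zeroˡ z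
  sum-*ʳ (suc n) f z =
    trans (distribʳ z (f fzero) _) (cong ((f fzero * z) +_) (sum-*ʳ n (λ i → f (fsuc i)) z))

  sum-*ˡ : ∀ n (f : Fin n → K) z → z * sumFin n f ≡ sumFin n (λ i → z * f i)
  sum-*ˡ n f z = begin
    z * sumFin n f                   ≡⟨ *-comm z (sumFin n f) ⟩
    sumFin n f * z                   ≡⟨ sum-*ʳ n f z ⟩
    sumFin n (λ i → f i * z)         ≡⟨ sum-cong n (λ i → *-comm (f i) z) ⟩
    sumFin n (λ i → z * f i)         ∎

  sum-sub : ∀ n (f g : Fin n → K) → sumFin n (λ i → f i + - g i) ≡ sumFin n f + - sumFin n g
  sum-sub zero    f g = sym (-‿inverseʳ 0#)
  sum-sub (suc n) f g = begin
    (f₀ + - g₀) + sumFin n (λ i → f (fsuc i) + - g (fsuc i))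
                                   ≡⟨ cong ((f₀ + - g₀) +_) (sum-sub n (λ i → f (fsuc i)) (λ i → g (fsuc i))) ⟩
    (f₀ + - g₀) + (Σf + - Σg)      ≡⟨ +-interchange f₀ (- g₀) Σf (- Σg) ⟩
    (f₀ + Σf) + (- g₀ + - Σg)      ≡⟨ cong ((f₀ + Σf) +_) (-‿+-comm g₀ Σg) ⟩
    (f₀ + Σf) + - (g₀ + Σg)        ∎
    where
    f₀ = f fzero
    g₀ = g fzero
    Σf = sumFin n (λ i → f (fsuc i))
    Σg = sumFin n (λ i → g (fsuc i))

  sum∈ : ∀ {S : Subset} → IsSubfield S → ∀ n (f : Fin n → K) → (∀ i → f i ∈ S) → sumFin n f ∈ S
  sum∈ sfS zero    f _  = IsSubfield.0∈ sfS
  sum∈ sfS (suc n) f f∈ = IsSubfield.+∈ sfS (f∈ fzero) (sum∈ sfS n (λ i → f (fsuc i)) (λ i → f∈ (fsuc i)))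

module LinearAlgebra (𝕂 : FiniteField) {F : FF.Subset 𝕂} (sfF : FF.IsSubfield 𝕂 F) where
  open FF 𝕂
  open OverF F
  open FieldFacts 𝕂
  open Sums 𝕂
  open IsSubfield sfF
  open ≡-Reasoning

  Independent : (k : ℕ) → (Fin k → K) → Set
  Independent k w = ∀ (c : Fin k → K) → (∀ i → c i ∈ F) →
    sumFin k (λ i → c i * w i) ≡ 0# → ∀ i → c i ≡ 0#

  Spans : Subset → (k : ℕ) → (Fin k → K) → Set
  Spans S k w = ∀ x → x ∈ S → InSpan k w x

  _◂_ : ∀ {k} → K → (Fin k → K) → Fin (suc k) → K
  (x ◂ w) fzero    = x
  (x ◂ w) (fsuc i) = w i

  ◂∈ : ∀ (S : Subset) {k x} {w : Fin k → K} → x ∈ S → (∀ i → w i ∈ S) → ∀ i → (x ◂ w) i ∈ S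
  ◂∈ S x∈S w∈S fzero    = x∈S
  ◂∈ S x∈S w∈S (fsuc i) = w∈S i

  span-◂ : ∀ {k} (w : Fin k → K) x {z} → InSpan k w z → InSpan (suc k) (x ◂ w) z
  span-◂ {k} w x {z} (c , c∈F , z≡) = (0# ◂ c) , ◂∈ F 0∈ c∈F ,
    trans z≡ (sym (0*x+s≡s x (sumFin k (λ i → c i * w i))))

  spans-pad : ∀ {S k} {w : Fin k → K} → Spans S k w → Spans S (suc k) (0# ◂ w)
  spans-pad {w = w} spans x x∈S = span-◂ w 0# (spans x x∈S)

  -- Adding a vector outside the span keeps a family independent: a nonzero
  -- coefficient of x would let us solve for x in terms of w.
  independent-◂ : ∀ {k} {w : Fin k → K} {x} → Independent k w → ¬ InSpan k w x →
                  Independent (suc k) (x ◂ w)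
  independent-◂ {k} {w} {x} ind x∉ c c∈F c₀x+rest≡0 = coefficient≡0
    where
    c₀ = c fzero
    rest = sumFin k (λ i → c (fsuc i) * w i)

    solve-for-x : c₀ ≢ 0# → InSpan k w x
    solve-for-x c₀≢0 = (λ i → - (c₀ ⁻¹) * c (fsuc i)) ,
                       (λ i → *∈ (-∈ (⁻¹∈ (c∈F fzero))) (c∈F (fsuc i))) , (begin
      x                                          ≡⟨ ⁻¹-*-cancelˡ c₀ x c₀≢0 ⟨
      c₀ ⁻¹ * (c₀ * x)                           ≡⟨ cong (c₀ ⁻¹ *_) (+-inverseˡ-unique _ _ c₀x+rest≡0) ⟩
      c₀ ⁻¹ * - rest                             ≡⟨ -‿distribʳ-* (c₀ ⁻¹) rest ⟨
      - (c₀ ⁻¹ * rest)                           ≡⟨ -‿distribˡ-* (c₀ ⁻¹) rest ⟩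
      - (c₀ ⁻¹) * rest                           ≡⟨ sum-*ˡ k (λ i → c (fsuc i) * w i) (- (c₀ ⁻¹)) ⟩
      sumFin k (λ i → - (c₀ ⁻¹) * (c (fsuc i) * w i)) ≡⟨ sum-cong k (λ i → *-assoc _ _ _) ⟨
      sumFin k (λ i → (- (c₀ ⁻¹) * c (fsuc i)) * w i) ∎)

    c₀≡0 : c₀ ≡ 0#
    c₀≡0 = decidable-stable (c₀ ≟ 0#) (λ c₀≢0 → x∉ (solve-for-x c₀≢0))

    rest≡0 : rest ≡ 0#
    rest≡0 = begin
      rest             ≡⟨ 0*x+s≡s x rest ⟨
      0# * x + rest    ≡⟨ cong (λ z → z * x + rest) c₀≡0 ⟨
      c₀ * x + rest    ≡⟨ c₀x+rest≡0 ⟩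
      0#               ∎

    coefficient≡0 : ∀ i → c i ≡ 0#
    coefficient≡0 fzero    = c₀≡0
    coefficient≡0 (fsuc i) = ind (λ j → c (fsuc j)) (λ j → c∈F (fsuc j)) rest≡0 i

  element-≡ : ∀ {S : Subset} {x y} (x∈S : x ∈ S) (y∈S : y ∈ S) →
              x ≡ y → _≡_ {A = Σ K (_∈ S)} (x , x∈S) (y , y∈S)
  element-≡ x∈S y∈S refl = cong (_ ,_) (T-irrelevant x∈S y∈S)

  funToFin-cong : ∀ {k n} (f g : Fin k → Fin n) → (∀ i → f i ≡ g i) → funToFin f ≡ funToFin g
  funToFin-cong {zero}  f g f≗g = refl
  funToFin-cong {suc k} f g f≗g = cong₂ combine (f≗g fzero) (funToFin-cong _ _ (λ i → f≗g (fsuc i)))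

  -- Enumerating F (|F| = q), the F-combinations of a k-family are indexed by
  -- Fin (q ^ k); for an independent family this indexing is injective.
  module Counting {q : ℕ} (hF : HasSize F q) where
    module Scalars = Inverse hF

    scalar : Fin q → K
    scalar i = proj₁ (Scalars.to i)

    scalar∈F : ∀ i → scalar i ∈ F
    scalar∈F i = proj₂ (Scalars.to i)

    scalar-injective : ∀ {i j} → scalar i ≡ scalar j → i ≡ j
    scalar-injective {i} {j} e = to-injective hF (element-≡ (scalar∈F i) (scalar∈F j) e)

    index : ∀ {λ'} → λ' ∈ F → Fin q
    index {λ'} λ'∈F = Scalars.from (λ' , λ'∈F)

    scalar-index : ∀ {λ'} (λ'∈F : λ' ∈ F) → scalar (index λ'∈F) ≡ λ'
    scalar-index λ'∈F = cong proj₁ (Scalars.strictlyInverseˡ (_ , λ'∈F))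

    -- F contains the distinct elements 0 and 1.
    2≤q : 2 ≤ q
    2≤q = Finₚ.injective⇒≤ {f = λ i → index (0-1∈F i)} (λ {i} {j} e → 0-1-injective (begin
      0-1 i                     ≡⟨ scalar-index (0-1∈F i) ⟨
      scalar (index (0-1∈F i))  ≡⟨ cong scalar e ⟩
      scalar (index (0-1∈F j))  ≡⟨ scalar-index (0-1∈F j) ⟩
      0-1 j                     ∎))
      where
      0-1 : Fin 2 → K
      0-1 fzero        = 0#
      0-1 (fsuc fzero) = 1#

      0-1∈F : ∀ i → 0-1 i ∈ F
      0-1∈F fzero        = 0∈
      0-1∈F (fsuc fzero) = 1∈

      0-1-injective : ∀ {i j} → 0-1 i ≡ 0-1 j → i ≡ j
      0-1-injective {fzero}      {fzero}      _ = refl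
      0-1-injective {fzero}      {fsuc fzero} e = ⊥-elim (0≢1 e)
      0-1-injective {fsuc fzero} {fzero}      e = ⊥-elim (1≢0 e)
      0-1-injective {fsuc fzero} {fsuc fzero} _ = refl

    combination : ∀ {k} → (Fin k → K) → Fin (q ^ k) → K
    combination {k} w i = sumFin k (λ j → scalar (finToFun i j) * w j)

    combination-in-span : ∀ {k} (w : Fin k → K) i → InSpan k w (combination w i)
    combination-in-span w i = (λ j → scalar (finToFun i j)) , (λ j → scalar∈F _) , refl

    span⇒combination : ∀ {k} (w : Fin k → K) {x} → InSpan k w x → ∃ λ i → x ≡ combination w i
    span⇒combination {k} w {x} (c , c∈F , x≡) = funToFin coeffs , (begin
      x                                                  ≡⟨ x≡ ⟩
      sumFin k (λ j → c j * w j)                         ≡⟨ sum-cong k (λ j → cong (_* w j) (decode j)) ⟩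
      sumFin k (λ j → scalar (finToFun (funToFin coeffs) j) * w j) ∎)
      where
      coeffs : Fin k → Fin q
      coeffs j = index (c∈F j)

      decode : ∀ j → c j ≡ scalar (finToFun (funToFin coeffs) j)
      decode j = begin
        c j                                       ≡⟨ scalar-index (c∈F j) ⟨
        scalar (coeffs j)                         ≡⟨ cong scalar (Finₚ.finToFun-funToFin coeffs j) ⟨
        scalar (finToFun (funToFin coeffs) j)     ∎

    -- Membership in an F-span is decidable: try all q^k combinations.
    inSpan? : ∀ k (w : Fin k → K) x → Dec (InSpan k w x)
    inSpan? k w x = map′ (λ (i , x≡) → subst (InSpan k w) (sym x≡) (combination-in-span w i))
                         (span⇒combination w)
                         (Finₚ.any? (λ i → x ≟ combination w i))

    combination-injective : ∀ {k} {w : Fin k → K} → Independent k w →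
                            ∀ {i j} → combination w i ≡ combination w j → i ≡ j
    combination-injective {k} {w} ind {i} {j} e = begin
      i                               ≡⟨ Finₚ.funToFin-finToFin {k} {q} i ⟨
      funToFin (finToFun {q} {k} i)   ≡⟨ funToFin-cong _ _ same-coefficients ⟩
      funToFin (finToFun {q} {k} j)   ≡⟨ Finₚ.funToFin-finToFin {k} {q} j ⟩
      j                               ∎
      where
      -- the coefficient differences annihilate w, hence vanish
      δ : Fin k → K
      δ l = scalar (finToFun i l) + - scalar (finToFun j l)

      δw≡0 : sumFin k (λ l → δ l * w l) ≡ 0#
      δw≡0 = begin
        sumFin k (λ l → δ l * w l)
          ≡⟨ sum-cong k (λ l → [y-z]x≈yx-zx (w l) _ _) ⟩
        sumFin k (λ l → scalar (finToFun i l) * w l + - (scalar (finToFun j l) * w l))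
          ≡⟨ sum-sub k _ _ ⟩
        combination w i + - combination w j
          ≡⟨ cong (_+ - combination w j) e ⟩
        combination w j + - combination w j
          ≡⟨ -‿inverseʳ (combination w j) ⟩
        0# ∎

      same-coefficients : ∀ l → finToFun i l ≡ finToFun j l
      same-coefficients l = scalar-injective (x∙y⁻¹≈ε⇒x≈y _ _
        (ind δ (λ l → +∈ (scalar∈F _) (-∈ (scalar∈F _))) δw≡0 l))

    independent-bound : ∀ {S : Subset} → IsSubfield S → F ⊆ S → ∀ {N} → HasSize S N →
                        ∀ {k} {w : Fin k → K} → (∀ i → w i ∈ S) → Independent k w → q ^ k ≤ N
    independent-bound {S} sfS F⊆S {N} hS {k} {w} w∈S ind =
      Finₚ.injective⇒≤ {f = embed} (λ e → combination-injective ind (cong proj₁ (from-injective hS e)))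
      where
      module Elements = Inverse hS

      combination∈S : ∀ i → combination w i ∈ S
      combination∈S i = sum∈ sfS k _ (λ j → IsSubfield.*∈ sfS (F⊆S _ (scalar∈F _)) (w∈S j))

      embed : Fin (q ^ k) → Fin N
      embed i = Elements.from (combination w i , combination∈S i)

  module _ {q m : ℕ} (hF : HasSize F q) {E : Subset} (sfE : IsSubfield E) (F⊆E : F ⊆ E)
           (hE : HasSize E (q ^ m)) where
    open Counting hF

    spans-or-escapes : ∀ k (w : Fin k → K) → Spans E k w ⊎ ∃ λ x → x ∈ E × ¬ InSpan k w x
    spans-or-escapes k w
      with ∃? (λ x → x ∈ E × ¬ InSpan k w x) (λ x → T? (E x) ×-dec ¬? (inSpan? k w x))
    ... | yes escape = inj₂ escape
    ... | no none    = inj₁ (λ x x∈E → decidable-stable (inSpan? k w x) (λ x∉ → none (x , x∈E , x∉)))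

    -- Greedy construction: at every length j there is an independent family in
    -- E, or a family spanning E (once a family spans, pad it with zeros).
    greedy : ∀ j → (Σ (Fin j → K) λ w → (∀ i → w i ∈ E) × Independent j w)
                 ⊎ (Σ (Fin j → K) λ w → Spans E j w)
    greedy zero = inj₁ ((λ ()) , (λ ()) , (λ _ _ _ ()))
    greedy (suc j) with greedy j
    ... | inj₂ (w , spans) = inj₂ (0# ◂ w , spans-pad spans)
    ... | inj₁ (w , w∈E , ind) with spans-or-escapes j w
    ...   | inj₁ spans = inj₂ (0# ◂ w , spans-pad spans)
    ...   | inj₂ (x , x∈E , x∉) = inj₁ (x ◂ w , ◂∈ E x∈E w∈E , independent-◂ ind x∉)

    -- At length m an independent family must already span: one more
    -- independent vector would give q^(m+1) ≤ |E| = q^m.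
    spanning-family : Σ (Fin m → K) λ w → Spans E m w
    spanning-family with greedy m
    ... | inj₂ found = found
    ... | inj₁ (w , w∈E , ind) with spans-or-escapes m w
    ...   | inj₁ spans = w , spans
    ...   | inj₂ (x , x∈E , x∉) =
      ⊥-elim (<⇒≱ (^-monoʳ-< q 2≤q (n<1+n m))
                  (independent-bound sfE F⊆E hE (◂∈ E x∈E w∈E) (independent-◂ ind x∉)))

  power-in-span : ∀ {E : Subset} → IsSubfield E → ∀ {k} {w : Fin k → K} → Spans E k w →
                  ∀ {x e c} d → e ∈ E → x ≡ e * c → x ≢ 0# →
                  InSpan k (λ i → w i * powℤ c d) (powℤ x d)
  power-in-span sfE {k} {w} spans {x} {e} {c} d e∈E x≡ec x≢0
    with spans (powℤ e d) (powℤ∈ sfE d e∈E)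
  ... | λs , λs∈F , eᵈ≡ = λs , λs∈F , (begin
    powℤ x d                                    ≡⟨ cong (λ z → powℤ z d) x≡ec ⟩
    powℤ (e * c) d                              ≡⟨ powℤ-distrib-* e c d e≢0 c≢0 ⟩
    powℤ e d * powℤ c d                         ≡⟨ cong (_* powℤ c d) eᵈ≡ ⟩
    sumFin k (λ i → λs i * w i) * powℤ c d      ≡⟨ sum-*ʳ k _ (powℤ c d) ⟩
    sumFin k (λ i → (λs i * w i) * powℤ c d)    ≡⟨ sum-cong k (λ i → *-assoc (λs i) (w i) (powℤ c d)) ⟩
    sumFin k (λ i → λs i * (w i * powℤ c d))    ∎)
    where
    ec≢0 : e * c ≢ 0#
    ec≢0 ec≡0 = x≢0 (trans x≡ec ec≡0)

    e≢0 : e ≢ 0#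
    e≢0 = nonzero-factorˡ e c ec≢0

    c≢0 : c ≢ 0#
    c≢0 = nonzero-factorʳ e c ec≢0

module Lines (𝕂 : FiniteField) {F : FF.Subset 𝕂} (sfF : FF.IsSubfield 𝕂 F) where
  open FF 𝕂
  open OverF F
  open FieldFacts 𝕂
  open IsSubfield sfF
  open ≡-Reasoning

  first∈line : ∀ a b → InLine a b a
  first∈line a b = 1# , 0# , 1∈ , 0∈ , (begin
    a                 ≡⟨ +-identityʳ a ⟨
    a + 0#            ≡⟨ cong₂ _+_ (*-identityˡ a) (zeroˡ b) ⟨
    1# * a + 0# * b   ∎)

  second∈line : ∀ a b → InLine a b b
  second∈line a b = 0# , 1# , 0∈ , 1∈ , (begin
    b                 ≡⟨ +-identityˡ b ⟨
    0# + b            ≡⟨ cong₂ _+_ (zeroˡ a) (*-identityˡ b) ⟨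
    0# * a + 1# * b   ∎)

  line-basis-nonzero : ∀ {a b} → IsLine a b → a ≢ 0#
  line-basis-nonzero {a} {b} line a≡0 = 1≢0 (proj₁ (line 1# 0# 1∈ 0∈ (begin
    1# * a + 0# * b   ≡⟨ cong₂ _+_ (trans (cong (1# *_) a≡0) (zeroʳ 1#)) (zeroˡ b) ⟩
    0# + 0#           ≡⟨ +-identityʳ 0# ⟩
    0#                ∎)))

  module Scaled {a b a' b' c : K} (a≡ : a ≡ a' * c) (b≡ : b ≡ b' * c) where

    combination-scale : ∀ λ₁ λ₂ → λ₁ * a + λ₂ * b ≡ (λ₁ * a' + λ₂ * b') * c
    combination-scale λ₁ λ₂ = begin
      λ₁ * a + λ₂ * b                  ≡⟨ cong₂ (λ u v → λ₁ * u + λ₂ * v) a≡ b≡ ⟩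
      λ₁ * (a' * c) + λ₂ * (b' * c)    ≡⟨ cong₂ _+_ (*-assoc λ₁ a' c) (*-assoc λ₂ b' c) ⟨
      (λ₁ * a') * c + (λ₂ * b') * c    ≡⟨ distribʳ c (λ₁ * a') (λ₂ * b') ⟨
      (λ₁ * a' + λ₂ * b') * c          ∎

    isLine-descale : IsLine a b → IsLine a' b'
    isLine-descale line λ₁ λ₂ λ₁∈F λ₂∈F λa'+λb'≡0 = line λ₁ λ₂ λ₁∈F λ₂∈F (begin
      λ₁ * a + λ₂ * b              ≡⟨ combination-scale λ₁ λ₂ ⟩
      (λ₁ * a' + λ₂ * b') * c      ≡⟨ cong (_* c) λa'+λb'≡0 ⟩
      0# * c                       ≡⟨ zeroˡ c ⟩
      0#                           ∎)

    contained-scale : ∀ {q m} → ContainedIn1dim q m a' b' → ContainedIn1dim q m a b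
    contained-scale (E , sfE , hE , F⊆E , c' , ℓ'⊆Ec') = E , sfE , hE , F⊆E , c' * c , ℓ⊆Ec'c
      where
      ℓ⊆Ec'c : ∀ x → InLine a b x → ∃[ e ] (e ∈ E × x ≡ e * (c' * c))
      ℓ⊆Ec'c x (λ₁ , λ₂ , λ₁∈F , λ₂∈F , x≡)
        with ℓ'⊆Ec' (λ₁ * a' + λ₂ * b') (λ₁ , λ₂ , λ₁∈F , λ₂∈F , refl)
      ... | e , e∈E , y≡ = e , e∈E , (begin
        x                            ≡⟨ x≡ ⟩
        λ₁ * a + λ₂ * b              ≡⟨ combination-scale λ₁ λ₂ ⟩
        (λ₁ * a' + λ₂ * b') * c      ≡⟨ cong (_* c) y≡ ⟩
        (e * c') * c                 ≡⟨ *-assoc e c' c ⟩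
        e * (c' * c)                 ∎)

  -- The order of a line is invariant under dividing its basis by a nonzero
  -- scalar (ℓ̂ and ℓ̂' = ℓ̂·c⁻¹ lie in the same number of 1-dim E-subspaces).
  order-descale : ∀ {q m a b a' b' c} → c ≢ 0# → a ≡ a' * c → b ≡ b' * c →
                  HasOrder q a b m → HasOrder q a' b' m
  order-descale {q} {m} {c = c} c≢0 a≡ b≡ (1≤m , contained , minimal) =
    1≤m ,
    Scaled.contained-scale (divide a≡) (divide b≡) {q} {m} contained ,
    λ m' 1≤m' m'<m contained' → minimal m' 1≤m' m'<m (Scaled.contained-scale a≡ b≡ {q} {m'} contained')
    where
    divide : ∀ {x x'} → x ≡ x' * c → x' ≡ x * c ⁻¹
    divide {x} {x'} x≡ = sym (trans (cong (_* c ⁻¹) x≡) (*-⁻¹-cancelʳ x' c c≢0))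

  scaling : (u : K) → u ≢ 0# → FLinearBijection
  scaling u u≢0 = record
    { φ        = _* u
    ; additive = λ x y → distribʳ u x y
    ; F-homog  = λ λ' x _ → *-assoc λ' x u
    ; bij      = (_* u ⁻¹) , (λ x → *-⁻¹-cancelʳ x u u≢0) , (λ y → ⁻¹-*-cancelʳ y u u≢0)
    }

  power-descale : ∀ {x y c} d → y ≢ 0# → c ≢ 0# → x ≡ y * c → powℤ x d * powℤ (c ⁻¹) d ≡ powℤ y d
  power-descale {x} {y} {c} d y≢0 c≢0 x≡ = begin
    powℤ x d * powℤ (c ⁻¹) d      ≡⟨ powℤ-distrib-* x (c ⁻¹) d x≢0 (⁻¹-nonzero c c≢0) ⟨
    powℤ (x * c ⁻¹) d             ≡⟨ cong (λ z → powℤ (z * c ⁻¹) d) x≡ ⟩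
    powℤ ((y * c) * c ⁻¹) d       ≡⟨ cong (λ z → powℤ z d) (*-⁻¹-cancelʳ y c c≢0) ⟩
    powℤ y d                      ∎
    where
    x≢0 : x ≢ 0#
    x≢0 x≡0 = *-nonzero y c y≢0 c≢0 (trans (sym x≡) x≡0)

  descaling : (c : K) → c ≢ 0# → ℤ → FLinearBijection
  descaling c c≢0 d = scaling (powℤ (c ⁻¹) d) (powℤ-nonzero (c ⁻¹) d (⁻¹-nonzero c c≢0))

  -- When ℓ̂ = ℓ̂'·c, the collineation x ↦ x·(c⁻¹)^d maps the point set ℓ^d
  -- onto ℓ'^d: the point ⟨(λ₁a + λ₂b)^d⟩ goes to ⟨(λ₁a' + λ₂b')^d⟩.
  powers-equivalent : ∀ {a b a' b' c} (d : ℤ) (c≢0 : c ≢ 0#) → a ≡ a' * c → b ≡ b' * c →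
    PGLEquivalentPowers (descaling c c≢0 d) d a b a' b'
  powers-equivalent {a} {b} {a'} {b'} {c} d c≢0 a≡ b≡ = forward , backward
    where
    open Scaled a≡ b≡

    same-point : ∀ {x y} → y ≢ 0# → x ≡ y * c → SamePoint (powℤ x d * powℤ (c ⁻¹) d) (powℤ y d)
    same-point y≢0 x≡ = 1# , 1∈ , 1≢0 , trans (power-descale d y≢0 c≢0 x≡) (sym (*-identityˡ _))

    forward : ∀ x → InLine a b x → x ≢ 0# →
              ∃[ y ] (InLine a' b' y × y ≢ 0# × SamePoint (powℤ x d * powℤ (c ⁻¹) d) (powℤ y d))
    forward x (λ₁ , λ₂ , λ₁∈F , λ₂∈F , x≡) x≢0 =
      λ₁ * a' + λ₂ * b' , (λ₁ , λ₂ , λ₁∈F , λ₂∈F , refl) , y≢0 , same-point y≢0 x≡yc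
      where
      x≡yc = trans x≡ (combination-scale λ₁ λ₂)
      y≢0 = nonzero-factorˡ _ c (λ yc≡0 → x≢0 (trans x≡yc yc≡0))

    backward : ∀ y → InLine a' b' y → y ≢ 0# →
               ∃[ x ] (InLine a b x × x ≢ 0# × SamePoint (powℤ x d * powℤ (c ⁻¹) d) (powℤ y d))
    backward y (λ₁ , λ₂ , λ₁∈F , λ₂∈F , y≡) y≢0 =
      λ₁ * a + λ₂ * b , (λ₁ , λ₂ , λ₁∈F , λ₂∈F , refl) , x≢0 , same-point y≢0 x≡yc
      where
      x≡yc = trans (combination-scale λ₁ λ₂) (cong (_* c) (sym y≡))
      x≢0 = λ x≡0 → *-nonzero y c y≢0 c≢0 (trans (sym x≡yc) x≡0)

proposition5p4 :
    (q t : ℕ) (𝕂 : FiniteField) → FiniteField.size 𝕂 ≡ q ^ t →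
    let open FF 𝕂 in
    (F : Subset) → IsSubfield F → HasSize F q →
    let open OverF F in
    (a b : K) → IsLine a b → (m : ℕ) → HasOrder q a b m → (d : ℤ) →
    (∃[ w ] (∀ x → InLine a b x → x ≢ 0# → InSpan m w (powℤ x d)))
    × (∃[ E ] (IsSubfield E × HasSize E (q ^ m) × F ⊆ E ×
        ∃[ a' ] ∃[ b' ] (a' ∈ E × b' ∈ E × IsLine a' b' × HasOrder q a' b' m ×
          ∃[ g ] PGLEquivalentPowers g d a b a' b')))
proposition5p4 q t 𝕂 _ F sfF hF a b line m order@(_ , (E , sfE , hE , F⊆E , c , ℓ⊆Ec) , _) d
  with ℓ⊆Ec a (Lines.first∈line 𝕂 sfF a b) | ℓ⊆Ec b (Lines.second∈line 𝕂 sfF a b)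
     | LinearAlgebra.spanning-family 𝕂 sfF hF sfE F⊆E hE
... | a' , a'∈E , a≡a'c | b' , b'∈E , b≡b'c | w , w-spans-E =
  ((λ i → w i * powℤ c d) , powers-in-span) ,
  (E , sfE , hE , F⊆E , a' , b' , a'∈E , b'∈E ,
   Scaled.isLine-descale a≡a'c b≡b'c line , order-descale c≢0 a≡a'c b≡b'c order ,
   descaling c c≢0 d , powers-equivalent d c≢0 a≡a'c b≡b'c)
  where
  open FF 𝕂
  open OverF F
  open FieldFacts 𝕂
  open LinearAlgebra 𝕂 sfF using (power-in-span)
  open Lines 𝕂 sfF

  c≢0 : c ≢ 0#
  c≢0 = nonzero-factorʳ a' c (λ a'c≡0 → line-basis-nonzero line (trans a≡a'c a'c≡0))

  powers-in-span : ∀ x → InLine a b x → x ≢ 0# → InSpan m (λ i → w i * powℤ c d) (powℤ x d)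
  powers-in-span x x∈ℓ x≢0 with ℓ⊆Ec x x∈ℓ
  ... | e , e∈E , x≡ec = power-in-span sfE w-spans-E d e∈E x≡ec x≢0
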